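{- The class of underlying undirected graphs of 2qBMGs is contained in the class of $P_6$-free chordal bipartite graphs.
   Context: A rooted phylogenetic tree $T$ is a rooted tree with root $\rho$ in which every non-leaf vertex has at least two children; $L=L(T)$ denotes its leaf set. Write $v\preceq_T u$ if $u$ lies on the path from $\rho$ to $v$, and $\mathrm{lca}_T(x,y)$ for the $\preceq_T$-smallest common ancestor of $x,y$. Let $\sigma\colon L\to S$ be a leaf coloring, where $S$ is a set of two colors. For leaves $x,y$ with $\sigma(x)\neq\sigma(y)$, $y$ is a best match of $x$ if $\mathrm{lca}_T(x,y)\preceq_T\mathrm{lca}_T(x,y')$ for all leaves $y'$ with $\sigma(y')=\sigma(y)$. A truncation map $u_T\colon L\times S\to V(T)$ assigns to each leaf $x$ and color $s$ a vertex on the path from $\rho$ to $x$, with $u_T(x,\sigma(x))=x$. A leaf $y$ is a quasi-best match of $x$ if $y$ is a best match of $x$ and $\mathrm{lca}_T(x,y)\preceq_T u_T(x,\sigma(y))$. The quasi-best match graph of $(T,\sigma,u_T)$ is the vertex-colored digraph on $L$ (colored by $\sigma$) with an arc $xy$ iff $y$ is a quasi-best match of $x$. A 2qBMG is a vertex-colored digraph with two colors that arises in this way. (Known equivalent characterization: a digraph with a proper 2-coloring is a 2qBMG iff (N1) there are no four distinct vertices $u,t,w,v$ with $u,v$ non-adjacent and $ut, vw, tw$ arcs; (N2) whenever $uv,vw,wt$ are arcs, $ut$ is an arc; (N3) for distinct $u,v$, if $N^+(u)\cap N^+(v)\neq\emptyset$ then $N^+(u)\subseteq N^+(v)$ or $N^+(v)\subseteq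 N^+(u)$.) The underlying undirected graph of a digraph has the same vertex set and an edge $uv$ whenever $uv$ or $vu$ is an arc. A graph is $P_6$-free if it has no induced subgraph isomorphic to the path on six vertices. A graph is chordal bipartite if it is bipartite and has no induced cycle of length at least six. -}

module Defs where

open import Data.Nat using (ℕ; zero; suc; _≤_; _∸_)
open import Data.Fin using (Fin; toℕ)
open import Data.Bool using (Bool)
open import Data.Product using (Σ; ∃; ∃-syntax; _×_; _,_)
open import Data.Sum using (_⊎_)
open import Relation.Nullary using (¬_)
open import Relation.Binary.PropositionalEquality using (_≡_; _≢_)
open import Function using (_∘_)
open import Function.Definitions using (Injective)

iter : ∀ {A : Set} → (A → A) → ℕ → A → A
iter f zero    a = a
iter f (suc k) a = f (iter f k a)

record RootedTree (n : ℕ) : Set where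
  field
    root     : Fin n
    parent   : Fin n → Fin n
    root-fix : parent root ≡ root
    -- every vertex reaches the root by following parents (so no cycles)
    reach    : ∀ v → ∃[ k ] iter parent k v ≡ root

  _⪯_ : Fin n → Fin n → Set
  v ⪯ u = ∃[ k ] iter parent k v ≡ u

  Child : Fin n → Fin n → Set
  Child u c = c ≢ root × parent c ≡ u

  IsLeaf : Fin n → Set
  IsLeaf v = ∀ c → ¬ Child v c

  Phylogenetic : Set
  Phylogenetic = ∀ u → (∃[ c ] Child u c) →
                 ∃[ c₁ ] ∃[ c₂ ] (Child u c₁ × Child u c₂ × c₁ ≢ c₂)

  IsLca : Fin n → Fin n → Fin n → Set
  IsLca x y w = x ⪯ w × y ⪯ w × (∀ z → x ⪯ z → y ⪯ z → w ⪯ z)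

  -- colours: S = Bool (two colours); σ is used on leaves only
  -- y is a best match of x
  BestMatch : (Fin n → Bool) → Fin n → Fin n → Set
  BestMatch σ x y =
    σ x ≢ σ y ×
    (∀ y' → IsLeaf y' → σ y' ≡ σ y →
       ∀ a b → IsLca x y a → IsLca x y' b → a ⪯ b)

  IsTruncationMap : (Fin n → Bool) → (Fin n → Bool → Fin n) → Set
  IsTruncationMap σ u =
    ∀ x → IsLeaf x → (∀ s → x ⪯ u x s) × u x (σ x) ≡ x

  QuasiBestMatch : (Fin n → Bool) → (Fin n → Bool → Fin n) → Fin n → Fin n → Set
  QuasiBestMatch σ u x y =
    BestMatch σ x y × (∀ a → IsLca x y a → a ⪯ u x (σ y))

open RootedTree public

Is2qBMG : {V : Set} → (V → V → Set) → (V → Bool) → Set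
Is2qBMG {V} arc col =
  ∃[ n ] Σ (RootedTree n) λ T →
  Σ (Fin n → Bool) λ σ → Σ (Fin n → Bool → Fin n) λ u →
  Σ (V → Fin n) λ φ →
    Phylogenetic T ×
    IsTruncationMap T σ u ×
    Injective _≡_ _≡_ φ ×
    (∀ x → IsLeaf T (φ x)) ×
    (∀ v → IsLeaf T v → ∃[ x ] φ x ≡ v) ×
    (∀ x → col x ≡ σ (φ x)) ×
    (∀ x y → (arc x y → QuasiBestMatch T σ u (φ x) (φ y))
           × (QuasiBestMatch T σ u (φ x) (φ y) → arc x y))

Underlying : {V : Set} → (V → V → Set) → V → V → Set
Underlying arc x y = arc x y ⊎ arc y x

PathAdj : ∀ {k} → Fin k → Fin k → Set
PathAdj i j = toℕ j ≡ suc (toℕ i) ⊎ toℕ i ≡ suc (toℕ j)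

CycSucc : ∀ {k} → Fin k → Fin k → Set
CycSucc {k} i j = toℕ j ≡ suc (toℕ i) ⊎ (toℕ i ≡ k ∸ 1 × toℕ j ≡ 0)

CycAdj : ∀ {k} → Fin k → Fin k → Set
CycAdj i j = CycSucc i j ⊎ CycSucc j i

InducedPath : {V : Set} → (V → V → Set) → ℕ → Set
InducedPath {V} E k =
  Σ (Fin k → V) λ f → Injective _≡_ _≡_ f ×
    (∀ i j → (E (f i) (f j) → PathAdj i j) × (PathAdj i j → E (f i) (f j)))

InducedCycle : {V : Set} → (V → V → Set) → ℕ → Set
InducedCycle {V} E k =
  Σ (Fin k → V) λ f → Injective _≡_ _≡_ f ×
    (∀ i j → (E (f i) (f j) → CycAdj i j) × (CycAdj i j → E (f i) (f j)))

P6Free : {V : Set} → (V → V → Set) → Set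
P6Free E = ¬ InducedPath E 6

Bipartite : {V : Set} → (V → V → Set) → Set
Bipartite {V} E = Σ (V → Bool) λ c → ∀ x y → E x y → c x ≢ c y

ChordalBipartite : {V : Set} → (V → V → Set) → Set
ChordalBipartite E = Bipartite E × (∀ k → 6 ≤ k → ¬ InducedCycle E k)

-- Arcs join vertices of different colours, so the colouring is a bipartition.  Given a walk
-- g₀ g₁ … g₍ₖ₋₁₎ (k ≥ 6) in the underlying graph, take the consecutive pair whose lca M lies
-- above every gᵢ (it exists since the ancestors of a vertex form a chain).  That pair carries
-- an arc x → y, and every leaf of y's colour below M is then a quasi-best match of x as well.
-- Hence x is adjacent to all gᵢ of the other colour, in particular to the vertex three steps
-- away from it along the walk, which is impossible in an induced P₆ or an induced Cₖ, k ≥ 6.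
module Submission where

open import Defs hiding (root; parent; root-fix; reach; _⪯_; IsLca; IsLeaf; QuasiBestMatch)
open import Data.Bool using (Bool)
open import Data.Bool.Properties using (¬-not)
open import Data.Empty using (⊥; ⊥-elim)
open import Data.Fin using (Fin; zero; suc; toℕ; fromℕ; fromℕ<; inject₁)
open import Data.Fin.Properties using (toℕ-fromℕ; toℕ-fromℕ<; toℕ-inject₁; toℕ<n; any?)
  renaming (_≟_ to _≟ᶠ_)
open import Data.Nat using (ℕ; zero; suc; _+_; _∸_; _≤_; _<_; s≤s; _<?_)
open import Data.Nat.Properties
open import Data.Product using (_×_; _,_; proj₁; proj₂; ∃; ∃-syntax)
open import Data.Sum using (_⊎_; inj₁; inj₂; swap)
open import Function using (_∘_)
open import Relation.Binary.Definitions using (Decidable)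
open import Relation.Nullary using (¬_; yes; no)
open import Relation.Binary.PropositionalEquality

iter-+ : ∀ {A : Set} (f : A → A) m k a → iter f (m + k) a ≡ iter f m (iter f k a)
iter-+ f zero    k a = refl
iter-+ f (suc m) k a = cong f (iter-+ f m k a)

iter-sucʳ : ∀ {A : Set} (f : A → A) k a → iter f (suc k) a ≡ iter f k (f a)
iter-sucʳ f k a = trans (cong (λ m → iter f m a) (+-comm 1 k)) (iter-+ f k 1 a)

iter-∸ : ∀ {A : Set} (f : A → A) {k l} a → k ≤ l → iter f (l ∸ k) (iter f k a) ≡ iter f l a
iter-∸ f {k} {l} a k≤l = trans (sym (iter-+ f (l ∸ k) k a)) (cong (λ m → iter f m a) (m∸n+n≡m k≤l))

iter-fixed : ∀ {A : Set} (f : A → A) {a} → f a ≡ a → ∀ m → iter f m a ≡ a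
iter-fixed f fa≡a zero    = refl
iter-fixed f fa≡a (suc m) = trans (cong f (iter-fixed f fa≡a m)) fa≡a

module TreeOrder {n : ℕ} (T : RootedTree n) where
  open RootedTree T using (root; parent; root-fix; reach; _⪯_; IsLca; IsLeaf; QuasiBestMatch)

  ⪯-refl : ∀ {a} → a ⪯ a
  ⪯-refl = 0 , refl

  ⪯-trans : ∀ {a b c} → a ⪯ b → b ⪯ c → a ⪯ c
  ⪯-trans {a} (k , refl) (l , refl) = l + k , iter-+ parent l k a

  ⪯-parent : ∀ a → a ⪯ parent a
  ⪯-parent a = 1 , refl

  ⪯-step : ∀ {a b} → a ⪯ b → a ≡ b ⊎ parent a ⪯ b
  ⪯-step (zero  , a≡b) = inj₁ a≡b
  ⪯-step {a} (suc k , e) = inj₂ (k , trans (sym (iter-sucʳ parent k a)) e)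

  ancestors-comparable : ∀ {v a b} → v ⪯ a → v ⪯ b → a ⪯ b ⊎ b ⪯ a
  ancestors-comparable {v} (k , refl) (l , refl) with ≤-total k l
  ... | inj₁ k≤l = inj₁ (l ∸ k , iter-∸ parent v k≤l)
  ... | inj₂ l≤k = inj₂ (k ∸ l , iter-∸ parent v l≤k)

  height : Fin n → ℕ
  height a = proj₁ (reach a)

  iter-beyond-height : ∀ a {j} → height a ≤ j → iter parent j a ≡ root
  iter-beyond-height a {j} h≤j = begin
    iter parent j a                            ≡⟨ sym (iter-∸ parent a h≤j) ⟩
    iter parent (j ∸ h) (iter parent h a)      ≡⟨ cong (iter parent (j ∸ h)) (proj₂ (reach a)) ⟩
    iter parent (j ∸ h) root                   ≡⟨ iter-fixed parent root-fix (j ∸ h) ⟩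
    root                                       ∎
    where
      open ≡-Reasoning
      h : ℕ
      h = height a

  ⪯-within-height : ∀ {a b} → a ⪯ b → ∃ λ (i : Fin (suc (height a))) → iter parent (toℕ i) a ≡ b
  ⪯-within-height {a} (j , e) with j <? suc (height a)
  ... | yes j<1+h = fromℕ< j<1+h , trans (cong (λ m → iter parent m a) (toℕ-fromℕ< j<1+h)) e
  ... | no  j≮1+h = fromℕ (height a) , (begin
    iter parent (toℕ (fromℕ (height a))) a ≡⟨ cong (λ m → iter parent m a) (toℕ-fromℕ (height a)) ⟩
    iter parent (height a) a               ≡⟨ proj₂ (reach a) ⟩
    root                                   ≡⟨ sym (iter-beyond-height a (<⇒≤ (≮⇒≥ j≮1+h))) ⟩
    iter parent j a                        ≡⟨ e ⟩
    _                                      ∎)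
    where open ≡-Reasoning

  _⪯?_ : Decidable _⪯_
  a ⪯? b with any? (λ (i : Fin (suc (height a))) → iter parent (toℕ i) a ≟ᶠ b)
  ... | yes (i , e) = yes (toℕ i , e)
  ... | no  ∄i      = no (∄i ∘ ⪯-within-height)

  -- Climb from x: the first ancestor of x lying above y is their lca.
  lca-climbing : ∀ m x y → iter parent m x ≡ root → ∃ (IsLca x y)
  lca-climbing m x y x↑≡root with y ⪯? x
  ... | yes y⪯x = x , ⪯-refl , y⪯x , λ _ x⪯z _ → x⪯z
  lca-climbing zero x y refl | no y⋠x = ⊥-elim (y⋠x (reach y))
  lca-climbing (suc m) x y x↑≡root | no y⋠x
    with lca-climbing m (parent x) y (trans (sym (iter-sucʳ parent m x)) x↑≡root)
  ... | w , px⪯w , y⪯w , least = w , ⪯-trans (⪯-parent x) px⪯w , y⪯w , least′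
    where
      least′ : ∀ z → x ⪯ z → y ⪯ z → w ⪯ z
      least′ z x⪯z y⪯z with ⪯-step x⪯z
      ... | inj₁ refl = ⊥-elim (y⋠x y⪯z)
      ... | inj₂ px⪯z = least z px⪯z y⪯z

  lca : ∀ x y → ∃ (IsLca x y)
  lca x y = lca-climbing (height x) x y (proj₂ (reach x))

  IsLca-sym : ∀ {x y w} → IsLca x y w → IsLca y x w
  IsLca-sym (x⪯w , y⪯w , least) = y⪯w , x⪯w , λ z y⪯z x⪯z → least z x⪯z y⪯z

  top-consecutive-lca : ∀ {k} (f : Fin (suc (suc k)) → Fin n) →
    ∃[ j ] ∃[ M ] IsLca (f (inject₁ j)) (f (suc j)) M × (∀ i → f i ⪯ M)
  top-consecutive-lca {zero} f with lca (f zero) (f (suc zero))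
  ... | M , lM@(f₀⪯M , f₁⪯M , _) = zero , M , lM , λ { zero → f₀⪯M ; (suc zero) → f₁⪯M }
  top-consecutive-lca {suc k} f with top-consecutive-lca (f ∘ suc) | lca (f zero) (f (suc zero))
  ... | j , M , lM , f⪯M | t , lt@(f₀⪯t , f₁⪯t , _) with ancestors-comparable f₁⪯t (f⪯M zero)
  ... | inj₁ t⪯M = suc j , M , lM , λ { zero → ⪯-trans f₀⪯t t⪯M ; (suc i) → f⪯M i }
  ... | inj₂ M⪯t = zero , t , lt , λ { zero → f₀⪯t ; (suc i) → ⪯-trans (f⪯M i) M⪯t }

  quasiBestMatch-below-lca : ∀ {σ u x y w M} → QuasiBestMatch σ u x y → IsLca x y M →
    w ⪯ M → σ w ≡ σ y → QuasiBestMatch σ u x w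
  quasiBestMatch-below-lca {σ} {u} {x} {y} {w} {M} ((σx≢σy , best) , truncated) lM@(x⪯M , _) w⪯M σw≡σy =
    (σx≢σw , best′) , λ a la → subst (λ s → a ⪯ u x s) (sym σw≡σy) (⪯-trans (below la) (truncated M lM))
    where
      σx≢σw : σ x ≢ σ w
      σx≢σw σx≡σw = σx≢σy (trans σx≡σw σw≡σy)
      below : ∀ {a} → IsLca x w a → a ⪯ M
      below (_ , _ , least) = least M x⪯M w⪯M
      best′ : ∀ y′ → IsLeaf y′ → σ y′ ≡ σ w → ∀ a b → IsLca x w a → IsLca x y′ b → a ⪯ b
      best′ y′ leaf σy′≡σw a b la lb = ⪯-trans (below la) (best y′ leaf (trans σy′≡σw σw≡σy) M b lM lb)

three-apart-¬PathAdj : ∀ {k} {i j : Fin k} → toℕ j ≡ 3 + toℕ i → ¬ PathAdj i j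
three-apart-¬PathAdj {i = i} j≡3+i (inj₁ j≡1+i) = m≢1+n+m (suc (toℕ i)) {1} (trans (sym j≡1+i) j≡3+i)
three-apart-¬PathAdj {i = i} j≡3+i (inj₂ i≡1+j) = m≢1+n+m (toℕ i) {3} (trans i≡1+j (cong suc j≡3+i))

three-apart-¬CycAdj : ∀ {k} {i j : Fin k} → 6 ≤ k → toℕ j ≡ 3 + toℕ i → ¬ CycAdj i j
three-apart-¬CycAdj _ j≡3+i (inj₁ (inj₁ j≡1+i))     = three-apart-¬PathAdj j≡3+i (inj₁ j≡1+i)
three-apart-¬CycAdj _ j≡3+i (inj₁ (inj₂ (_ , j≡0))) = 1+n≢0 (trans (sym j≡3+i) j≡0)
three-apart-¬CycAdj _ j≡3+i (inj₂ (inj₁ i≡1+j))     = three-apart-¬PathAdj j≡3+i (inj₂ i≡1+j)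
three-apart-¬CycAdj (s≤s 5≤k-1) j≡3+i (inj₂ (inj₂ (j≡k-1 , i≡0))) =
  m+1+n≰m 3 (subst (5 ≤_) (trans (sym j≡k-1) (trans j≡3+i (cong (3 +_) i≡0))) 5≤k-1)

record ThreeGapWalk {V : Set} (E : V → V → Set) (k : ℕ) : Set where
  field
    vertex   : Fin k → V
    step     : ∀ i j → toℕ j ≡ suc (toℕ i) → E (vertex i) (vertex j)
    no-chord : ∀ i j → toℕ j ≡ 3 + toℕ i → ¬ E (vertex i) (vertex j)

inducedPath⇒ThreeGapWalk : ∀ {V : Set} {E : V → V → Set} {k} → InducedPath E k → ThreeGapWalk E k
inducedPath⇒ThreeGapWalk (g , _ , adj) = record
  { vertex   = g
  ; step     = λ i j j≡1+i → proj₂ (adj i j) (inj₁ j≡1+i)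
  ; no-chord = λ i j j≡3+i → three-apart-¬PathAdj j≡3+i ∘ proj₁ (adj i j)
  }

inducedCycle⇒ThreeGapWalk : ∀ {V : Set} {E : V → V → Set} {k} → 6 ≤ k → InducedCycle E k → ThreeGapWalk E k
inducedCycle⇒ThreeGapWalk 6≤k (g , _ , adj) = record
  { vertex   = g
  ; step     = λ i j j≡1+i → proj₂ (adj i j) (inj₁ (inj₁ j≡1+i))
  ; no-chord = λ i j j≡3+i → three-apart-¬CycAdj 6≤k j≡3+i ∘ proj₁ (adj i j)
  }

predecessor : ∀ {k m} (j : Fin k) → toℕ j ≡ suc m → ∃ λ (i : Fin k) → toℕ i ≡ m
predecessor (suc i) 1+i≡1+m = inject₁ i , trans (toℕ-inject₁ i) (suc-injective 1+i≡1+m)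

three-apart-partner : ∀ {k} → 6 ≤ k → (i : Fin k) → ∃[ j ] (toℕ j ≡ 3 + toℕ i ⊎ toℕ i ≡ 3 + toℕ j)
three-apart-partner {k} 6≤k i with 3 + toℕ i <? k
... | yes 3+i<k = fromℕ< 3+i<k , inj₁ (toℕ-fromℕ< 3+i<k)
... | no  3+i≮k = fromℕ< i-3<k , inj₂ (begin
  toℕ i                      ≡⟨ sym (m+[n∸m]≡n 3≤i) ⟩
  3 + (toℕ i ∸ 3)            ≡⟨ cong (3 +_) (sym (toℕ-fromℕ< i-3<k)) ⟩
  3 + toℕ (fromℕ< i-3<k)     ∎)
  where
    open ≡-Reasoning
    3≤i : 3 ≤ toℕ i
    3≤i = +-cancelˡ-≤ 3 3 (toℕ i) (≤-trans 6≤k (≮⇒≥ 3+i≮k))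
    i-3<k : toℕ i ∸ 3 < k
    i-3<k = ≤-<-trans (m∸n≤m (toℕ i) 3) (toℕ<n i)

two-colours : ∀ {a b c : Bool} → a ≢ b → c ≢ b → a ≡ c
two-colours a≢b c≢b = trans (¬-not a≢b) (sym (¬-not c≢b))

module Realization {V : Set} (arc : V → V → Set) (col : V → Bool) {n : ℕ} (T : RootedTree n)
  (σ : Fin n → Bool) (u : Fin n → Bool → Fin n) (φ : V → Fin n)
  (col≡σ : ∀ x → col x ≡ σ (φ x))
  (arc⇔qbm : ∀ x y → (arc x y → RootedTree.QuasiBestMatch T σ u (φ x) (φ y))
                   × (RootedTree.QuasiBestMatch T σ u (φ x) (φ y) → arc x y)) where
  open RootedTree T using (_⪯_; IsLca)
  open TreeOrder T

  E : V → V → Set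
  E = Underlying arc

  arc-colours-differ : ∀ {x y} → arc x y → col x ≢ col y
  arc-colours-differ {x} {y} xy cx≡cy =
    proj₁ (proj₁ (proj₁ (arc⇔qbm x y) xy)) (trans (sym (col≡σ x)) (trans cx≡cy (col≡σ y)))

  edge-colours-differ : ∀ {x y} → E x y → col x ≢ col y
  edge-colours-differ (inj₁ xy) = arc-colours-differ xy
  edge-colours-differ (inj₂ yx) = arc-colours-differ yx ∘ sym

  arc-below-lca : ∀ {x y w M} → arc x y → IsLca (φ x) (φ y) M → φ w ⪯ M → col w ≢ col x → arc x w
  arc-below-lca {x} {y} {w} xy lM w⪯M cw≢cx = proj₂ (arc⇔qbm x w)
    (quasiBestMatch-below-lca {u = u} (proj₁ (arc⇔qbm x y) xy) lM w⪯M (begin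
      σ (φ w) ≡⟨ sym (col≡σ w) ⟩
      col w   ≡⟨ two-colours cw≢cx (arc-colours-differ xy ∘ sym) ⟩
      col y   ≡⟨ col≡σ y ⟩
      σ (φ y) ∎))
    where open ≡-Reasoning

  -- The arc on the consecutive pair with the highest lca reaches every vertex of the other colour.
  dominating-vertex : ∀ {k} (g : Fin (suc (suc k)) → V) → (∀ j → E (g (inject₁ j)) (g (suc j))) →
    ∃[ i₀ ] ∀ i → col (g i) ≢ col (g i₀) → E (g i₀) (g i)
  dominating-vertex g consecutive with top-consecutive-lca (φ ∘ g)
  ... | j , M , lM , g⪯M with consecutive j
  ... | inj₁ xy = inject₁ j , λ i c → inj₁ (arc-below-lca xy lM (g⪯M i) c)
  ... | inj₂ yx = suc j , λ i c → inj₁ (arc-below-lca yx (IsLca-sym lM) (g⪯M i) c)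

  module _ {k} (W : ThreeGapWalk E k) where
    open ThreeGapWalk W

    three-apart-colours-differ : ∀ {i j} → toℕ j ≡ 3 + toℕ i → col (vertex i) ≢ col (vertex j)
    three-apart-colours-differ {i} {j} j≡3+i with predecessor j j≡3+i
    ... | j₂ , j₂≡2+i with predecessor j₂ j₂≡2+i
    ... | j₁ , j₁≡1+i = λ ci≡cj → c₂≢cj (trans (sym ci≡c₂) ci≡cj)
      where
        c₂≢cj : col (vertex j₂) ≢ col (vertex j)
        c₂≢cj = edge-colours-differ (step j₂ j (trans j≡3+i (cong suc (sym j₂≡2+i))))
        ci≡c₂ : col (vertex i) ≡ col (vertex j₂)
        ci≡c₂ = two-colours (edge-colours-differ (step i j₁ j₁≡1+i))
                            (edge-colours-differ (step j₁ j₂ (trans j₂≡2+i (cong suc (sym j₁≡1+i)))) ∘ sym)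

    ¬ThreeGapWalk : 6 ≤ k → ⊥
    ¬ThreeGapWalk 6≤k@(s≤s (s≤s _))
      with dominating-vertex vertex (λ j → step (inject₁ j) (suc j) (cong suc (sym (toℕ-inject₁ j))))
    ... | i₀ , dominates with three-apart-partner 6≤k i₀
    ... | j , inj₁ j≡3+i₀ = no-chord i₀ j j≡3+i₀ (dominates j (three-apart-colours-differ j≡3+i₀ ∘ sym))
    ... | j , inj₂ i₀≡3+j = no-chord j i₀ i₀≡3+j (swap (dominates j (three-apart-colours-differ i₀≡3+j)))

corollary3p3 : {V : Set} (arc : V → V → Set) (col : V → Bool) →
    Is2qBMG arc col →
    P6Free (Underlying arc) × ChordalBipartite (Underlying arc)
corollary3p3 arc col (_ , T , σ , u , φ , _ , _ , _ , _ , _ , col≡σ , arc⇔qbm) =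
  (λ P₆ → ¬ThreeGapWalk (inducedPath⇒ThreeGapWalk P₆) ≤-refl) ,
  (col , λ _ _ → edge-colours-differ) ,
  (λ k 6≤k Cₖ → ¬ThreeGapWalk (inducedCycle⇒ThreeGapWalk 6≤k Cₖ) 6≤k)
  where open Realization arc col T σ u φ col≡σ arc⇔qbm
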